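{- Let $\tilde{\mathcal P}$ be a finite distributive lattice and let $\mathcal P\subset\tilde{\mathcal P}$ be a subposet (with the induced order) such that if $I\in\mathcal P$, $I'\in\tilde{\mathcal P}$ and $I'\preccurlyeq I$, then $I'\in\mathcal P$. Then $D_{\mathcal P}(1)\le 0$. Furthermore, the following are equivalent: $D_{\mathcal P}(1)=0$; $\mathcal P$ is a distributive lattice; $D_{\mathcal P}\equiv 0$.
   Context: For a finite poset $(\mathcal P,\preccurlyeq)$ and $x\in\mathcal P$, let $\kappa(x)$ be the number of elements of $\mathcal P$ covered by $x$ and $\iota(x)$ the number of elements of $\mathcal P$ that cover $x$. The upper covering polynomial is $\mathcal K^{u}_{\mathcal P}(q)=\sum_{x\in\mathcal P}q^{\kappa(x)}$ and the lower covering polynomial is $\mathcal K^{l}_{\mathcal P}(q)=\sum_{x\in\mathcal P}q^{\iota(x)}$. Since $\mathcal K^{u}_{\mathcal P}(1)=\mathcal K^{l}_{\mathcal P}(1)$ and $(\mathcal K^{u}_{\mathcal P})'(1)=(\mathcal K^{l}_{\mathcal P})'(1)$, one has $\mathcal K^{u}_{\mathcal P}-\mathcal K^{l}_{\mathcal P}=(q-1)^2D_{\mathcal P}(q)$ for a unique polynomial $D_{\mathcal P}$, the deviation polynomial. -}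

module Defs where

open import Data.Bool using (Bool; true; false; _∧_; _∨_; not; if_then_else_; T)
open import Data.Nat using (ℕ; zero; suc; _≡ᵇ_)
open import Data.Fin using (Fin; zero; suc)
open import Data.Fin.Properties using () renaming (_≟_ to _≟ᶠ_)
open import Data.Integer using (ℤ; +_; _-_; _*_) renaming (_+_ to _+ℤ_)
open import Data.List using (List; []; _∷_; foldr)
open import Data.Product using (Σ; proj₁)
open import Relation.Nullary.Decidable using (⌊_⌋)
open import Relation.Binary.PropositionalEquality using (_≡_)
open import Relation.Binary.Lattice.Structures using (IsDistributiveLattice)

countFin : ∀ {n} → (Fin n → Bool) → ℕ
countFin {zero}  f = 0
countFin {suc n} f = (if f zero then 1 else 0) Data.Nat.+ countFin (λ i → f (suc i))

anyFin : ∀ {n} → (Fin n → Bool) → Bool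
anyFin {zero}  f = false
anyFin {suc n} f = f zero ∨ anyFin (λ i → f (suc i))

-- The ambient finite poset is carried by Fin n with a Boolean order
-- relation  le x y = true  iff  x ≼ y .  A subposet P is a Boolean
-- predicate on Fin n, with the induced order.

module Covering {n : ℕ} (le : Fin n → Fin n → Bool) (P : Fin n → Bool) where

  lt : Fin n → Fin n → Bool
  lt x y = le x y ∧ not ⌊ x ≟ᶠ y ⌋

  -- x covers y in the induced subposet P (both assumed in P):
  -- y ≺ x and no z ∈ P with y ≺ z ≺ x
  covers : Fin n → Fin n → Bool
  covers x y = lt y x ∧ not (anyFin (λ z → P z ∧ lt y z ∧ lt z x))

  κ : Fin n → ℕ
  κ x = countFin (λ y → P y ∧ covers x y)

  ι : Fin n → ℕ
  ι x = countFin (λ y → P y ∧ covers y x)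

  -- k-th coefficient of the upper covering polynomial  Σ_{x∈P} q^κ(x)
  Kᵘ-coeff : ℕ → ℤ
  Kᵘ-coeff k = + countFin (λ x → P x ∧ (κ x ≡ᵇ k))

  -- k-th coefficient of the lower covering polynomial  Σ_{x∈P} q^ι(x)
  Kˡ-coeff : ℕ → ℤ
  Kˡ-coeff k = + countFin (λ x → P x ∧ (ι x ≡ᵇ k))

-- Integer polynomials as coefficient lists (constant term first)

Poly : Set
Poly = List ℤ

coeff : Poly → ℕ → ℤ
coeff []       k       = + 0
coeff (a ∷ as) zero    = a
coeff (a ∷ as) (suc k) = coeff as k

-- k-th coefficient of (q - 1)^2 · D  =  (q² - 2q + 1) · D
sqMul-coeff : Poly → ℕ → ℤ
sqMul-coeff D zero          = coeff D 0
sqMul-coeff D (suc zero)    = coeff D 1 - (+ 2) * coeff D 0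
sqMul-coeff D (suc (suc k)) = (coeff D (suc (suc k)) - (+ 2) * coeff D (suc k)) +ℤ coeff D k

eval1 : Poly → ℤ
eval1 = foldr _+ℤ_ (+ 0)

IsZeroPoly : Poly → Set
IsZeroPoly D = ∀ k → coeff D k ≡ + 0

IsDistLatticeOrder : ∀ {n} → (Fin n → Fin n → Bool) → Set
IsDistLatticeOrder {n} le =
  Σ (Fin n → Fin n → Fin n) λ ⊔ → Σ (Fin n → Fin n → Fin n) λ ⊓ →
    IsDistributiveLattice _≡_ (λ x y → T (le x y)) ⊔ ⊓

Elem : ∀ {n} → (Fin n → Bool) → Set
Elem {n} P = Σ (Fin n) (λ i → T (P i))

IsDistLatticeSub : ∀ {n} → (Fin n → Fin n → Bool) → (Fin n → Bool) → Set
IsDistLatticeSub {n} le P =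
  Σ (Elem P → Elem P → Elem P) λ ⊔ → Σ (Elem P → Elem P → Elem P) λ ⊓ →
    IsDistributiveLattice (λ a b → proj₁ a ≡ proj₁ b)
                          (λ a b → T (le (proj₁ a) (proj₁ b))) ⊔ ⊓

DownClosed : ∀ {n} → (Fin n → Fin n → Bool) → (Fin n → Bool) → Set
DownClosed {n} le P = ∀ (I I' : Fin n) → T (P I) → T (le I' I) → T (P I')

module Submission where

-- Write F = Kᵘ - Kˡ = (q - 1)² D. Then 2 D(1) = F″(1) = Σ κ(κ - 1) - Σ ι(ι - 1) over P, and
-- both sums count triples: an element together with an ordered pair of distinct lower (resp.
-- upper) covers. In a distributive lattice, if x covers y ≠ z then x = y ⊔ z, and y ⊓ z is
-- covered by both y and z; P being down-closed, this injects the first kind of triple into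
-- the second, whence D(1) ≤ 0. Equality means that whenever two elements of P cover a common
-- element their join lies in P, and a down-set with this property is closed under joins, i.e.
-- a sublattice. Conversely, in that case the lower covers of x correspond to the maximal
-- join-primes below x and the upper covers of y to the minimal join-primes of P not below y.
-- Sending x to the largest element of P above none of the former is then an injection
-- φ : P → P with ι ∘ φ = κ, so Kᵘ and Kˡ have the same coefficients and D = 0.

open import Defs
open import Data.Bool using (Bool; true; false; _∧_; not; if_then_else_; T)
open import Data.Bool.Properties using (T-∧; T-∨; ∧-identityʳ)
open import Data.Empty using (⊥-elim)
open import Data.Fin as Fin using (Fin; zero; suc; toℕ)
open import Data.Fin.Induction using (po-wellFounded; po-noetherian)
open import Data.Fin.Properties
  using (suc-injective; any?; all?; toℕ-inject₁; toℕ-fromℕ; toℕ-fromℕ<) renaming (_≟_ to _≟ᶠ_)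
open import Data.Integer using (ℤ; +_; _≤_; _-_; _+_; _*_; +≤+)
import Data.Integer.Properties as ℤ
open import Data.Integer.Tactic.RingSolver using (solve-∀)
open import Data.List using ([]; _∷_; length)
open import Data.Nat as ℕ using (ℕ; zero; suc; _∸_; _≡ᵇ_; z≤n; s≤s)
import Data.Nat.Properties as ℕ
open import Data.Product using (∃; _×_; _,_; proj₁; proj₂)
open import Data.Sum using (_⊎_; inj₁; inj₂)
open import Function using (_∘_; flip; case_of_; _⇔_; Equivalence; mk⇔)
open import Induction.WellFounded using (WfRec; module All)
open import Level using (0ℓ; _⊔_)
open import Relation.Binary using (Rel; Decidable; IsPartialOrder)
import Relation.Binary.Construct.On as On
open import Relation.Binary.Lattice using (IsDistributiveLattice; DistributiveLattice)
open import Relation.Binary.PropositionalEquality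
  using (_≡_; _≢_; refl; sym; trans; cong; cong₂; subst; subst₂; module ≡-Reasoning)
open import Relation.Nullary using (¬_; yes; no; contradiction)
open import Relation.Nullary.Decidable
  using (⌊_⌋; T?; toWitness; fromWitness; toWitnessFalse; fromWitnessFalse; decidable-stable;
         _×-dec_; _⊎-dec_; _→-dec_; ¬?)
open import Relation.Unary as U using (Pred)
open import Relation.Unary.Properties using (U?)
open import Algebra.Properties.Semiring.Sum ℕ.+-*-semiring
  using (sum-syntax; ∑-comm; sum-cong-≗; *-distribˡ-sum; *-distribʳ-sum; sum-replicate-zero)
import Algebra.Properties.Semiring.Sum ℤ.+-*-semiring as ℤΣ

𝟙 : Bool → ℕ
𝟙 b = if b then 1 else 0

countFin≡∑𝟙 : ∀ {n} (p : Fin n → Bool) → countFin p ≡ ∑[ i < n ] 𝟙 (p i)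
countFin≡∑𝟙 {zero}  p = refl
countFin≡∑𝟙 {suc n} p = cong (𝟙 (p zero) ℕ.+_) (countFin≡∑𝟙 (p ∘ suc))

𝟙-mono : ∀ {a b} → (T a → T b) → 𝟙 a ℕ.≤ 𝟙 b
𝟙-mono {false}         _   = z≤n
𝟙-mono {true}  {true}  _   = ℕ.≤-refl
𝟙-mono {true}  {false} a⇒b = ⊥-elim (a⇒b _)

𝟙≤1 : ∀ b → 𝟙 b ℕ.≤ 1
𝟙≤1 b = 𝟙-mono {b} {true} _

T-not : ∀ {b} → T (not b) ⇔ (¬ T b)
T-not {false} = mk⇔ (λ _ ()) (λ _ → _)
T-not {true}  = mk⇔ (λ ()) (λ ¬t → ¬t _)

anyFin⁻ : ∀ {n} {f : Fin n → Bool} → T (anyFin f) → ∃ λ i → T (f i)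
anyFin⁻ {suc n} {f} any with f zero in eq
... | true  = zero , subst T (sym eq) _
... | false = let i , fi = anyFin⁻ {f = f ∘ suc} any in suc i , fi

anyFin⁺ : ∀ {n} {f : Fin n → Bool} {i} → T (f i) → T (anyFin f)
anyFin⁺ {f = f} {zero}  fi = Equivalence.from T-∨ (inj₁ fi)
anyFin⁺ {f = f} {suc i} fi = Equivalence.from (T-∨ {f zero}) (inj₂ (anyFin⁺ {f = f ∘ suc} fi))

T-∧⁻ : ∀ {a b} → T (a ∧ b) → T a × T b
T-∧⁻ = Equivalence.to T-∧

T-∧⁺ : ∀ {a b} → T a → T b → T (a ∧ b)
T-∧⁺ ta tb = Equivalence.from T-∧ (ta , tb)

countFin-cong : ∀ {n} {p q : Fin n → Bool} → (∀ i → p i ≡ q i) → countFin p ≡ countFin q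
countFin-cong {zero}  _   = refl
countFin-cong {suc n} p≗q = cong₂ (λ b c → 𝟙 b ℕ.+ c) (p≗q zero) (countFin-cong (p≗q ∘ suc))

countFin-mono : ∀ {n} {p q : Fin n → Bool} → (∀ i → T (p i) → T (q i)) →
                countFin p ℕ.≤ countFin q
countFin-mono {zero}  _   = z≤n
countFin-mono {suc n} p⊆q = ℕ.+-mono-≤ (𝟙-mono (p⊆q zero)) (countFin-mono (p⊆q ∘ suc))

countFin≤n : ∀ {n} (p : Fin n → Bool) → countFin p ℕ.≤ n
countFin≤n {zero}  p = z≤n
countFin≤n {suc n} p = ℕ.+-mono-≤ (𝟙≤1 (p zero)) (countFin≤n (p ∘ suc))

countFin-none : ∀ {n} {p : Fin n → Bool} → (∀ i → ¬ T (p i)) → countFin p ≡ 0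
countFin-none {zero}          _    = refl
countFin-none {suc n} {p} none with p zero | none zero
... | false | _   = countFin-none (none ∘ suc)
... | true  | ¬p0 = contradiction _ ¬p0

⌊suc≟suc⌋ : ∀ {n} (i j : Fin n) → ⌊ suc i ≟ᶠ suc j ⌋ ≡ ⌊ i ≟ᶠ j ⌋
⌊suc≟suc⌋ i j with i ≟ᶠ j
... | yes _ = refl
... | no  _ = refl

countFin-remove : ∀ {n} {p : Fin n → Bool} {i} → T (p i) →
                  countFin p ≡ suc (countFin (λ j → p j ∧ not ⌊ j ≟ᶠ i ⌋))
countFin-remove {suc n} {p} {zero}  pi with p zero
... | true = cong suc (countFin-cong (λ j → sym (∧-identityʳ (p (suc j)))))
countFin-remove {suc n} {p} {suc i} pi
  with p zero | trans (countFin-remove {p = p ∘ suc} pi) (cong suc (countFin-cong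
                  (λ j → cong (λ b → p (suc j) ∧ not b) (sym (⌊suc≟suc⌋ j i)))))
... | true  | tail-removed = cong suc tail-removed
... | false | tail-removed = tail-removed

countFin-≐ : ∀ {n} {p q : Fin n → Bool} → (∀ i → T (p i) → T (q i)) → (∀ i → T (q i) → T (p i)) →
             countFin p ≡ countFin q
countFin-≐ p⊆q q⊆p = ℕ.≤-antisym (countFin-mono p⊆q) (countFin-mono q⊆p)

countFin-witness : ∀ {n} {p : Fin n → Bool} {i} → T (p i) → 0 ℕ.< countFin p
countFin-witness {p = p} pi = subst (0 ℕ.<_) (sym (countFin-remove {p = p} pi)) (s≤s z≤n)

countFin>0⇒∃ : ∀ {n} {p : Fin n → Bool} → 0 ℕ.< countFin p → ∃ λ i → T (p i)
countFin>0⇒∃ {p = p} 0<count with any? (T? ∘ p)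
... | yes witness = witness
... | no  none    = contradiction (countFin-none (λ i pi → none (i , pi))) (ℕ.>⇒≢ 0<count)

countFin-injection : ∀ {m n} {p : Fin m → Bool} {q : Fin n → Bool}
  (f : ∀ i → T (p i) → Fin n) → (∀ i pi → T (q (f i pi))) →
  (∀ {i j} pi pj → f i pi ≡ f j pj → i ≡ j) → countFin p ℕ.≤ countFin q
countFin-injection {zero} _ _ _ = z≤n
countFin-injection {suc m} {p = p} {q} f f∈q f-inj with p zero in eq
... | false = countFin-injection (f ∘ suc) (f∈q ∘ suc) (λ pi pj → suc-injective ∘ f-inj pi pj)
... | true  = ℕ.≤-trans (s≤s (countFin-injection f′ f′∈q′ (λ pi pj → suc-injective ∘ f-inj pi pj)))
                        (ℕ.≤-reflexive (sym (countFin-remove {p = q} (f∈q zero p0))))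
  where
  p0 : T (p zero)
  p0 = subst T (sym eq) _
  f′ : ∀ i → T (p (suc i)) → Fin _
  f′ i = f (suc i)
  f′∈q′ : ∀ i pi → T (q (f′ i pi) ∧ not ⌊ f′ i pi ≟ᶠ f zero p0 ⌋)
  f′∈q′ i pi = T-∧⁺ (f∈q (suc i) pi) (fromWitnessFalse (λ f≡f0 → 0≢suc (f-inj p0 pi (sym f≡f0))))
    where
    0≢suc : ∀ {m} {i : Fin m} → Fin.zero ≢ suc i
    0≢suc ()

∑-mono-≤ : ∀ {n} {f g : Fin n → ℕ} → (∀ i → f i ℕ.≤ g i) → ∑[ i < n ] f i ℕ.≤ ∑[ i < n ] g i
∑-mono-≤ {zero}  _   = z≤n
∑-mono-≤ {suc n} f≤g = ℕ.+-mono-≤ (f≤g zero) (∑-mono-≤ (f≤g ∘ suc))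

∑≡∑⇒≗ : ∀ {n} {f g : Fin n → ℕ} → (∀ i → f i ℕ.≤ g i) →
        ∑[ i < n ] f i ≡ ∑[ i < n ] g i → ∀ i → f i ≡ g i
∑≡∑⇒≗ {suc n} {f} {g} f≤g ∑f≡∑g = λ where
    zero    → head≡
    (suc i) → ∑≡∑⇒≗ (f≤g ∘ suc) tail≡ i
  where
  tail≤ = ∑-mono-≤ (f≤g ∘ suc)
  head≡ : f zero ≡ g zero
  head≡ = ℕ.≤-antisym (f≤g zero)
    (ℕ.+-cancelʳ-≤ _ _ _ (ℕ.≤-trans (ℕ.+-monoʳ-≤ (g zero) tail≤) (ℕ.≤-reflexive (sym ∑f≡∑g))))
  tail≡ : ∑[ i < n ] f (suc i) ≡ ∑[ i < n ] g (suc i)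
  tail≡ = ℕ.+-cancelˡ-≡ (f zero) _ _ (trans ∑f≡∑g (cong (ℕ._+ _) (sym head≡)))

pairs : ℕ → ℕ
pairs k = k ℕ.* (k ∸ 1)

𝟙*countFin : ∀ {n} a (q : Fin n → Bool) → 𝟙 a ℕ.* countFin q ≡ countFin (λ i → a ∧ q i)
𝟙*countFin {n} false q = sym (countFin-none {n} {λ _ → false} (λ _ ()))
𝟙*countFin true  q = ℕ.+-identityʳ (countFin q)

pairs-countFin : ∀ {n} (c : Fin n → Bool) →
  pairs (countFin c) ≡ ∑[ y < n ] countFin (λ z → c y ∧ (c z ∧ not ⌊ z ≟ᶠ y ⌋))
pairs-countFin {n} c = sym (begin
  ∑[ y < n ] countFin (λ z → c y ∧ (c z ∧ not ⌊ z ≟ᶠ y ⌋))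
    ≡⟨ sum-cong-≗ (λ y → sym (𝟙*countFin (c y) (λ z → c z ∧ not ⌊ z ≟ᶠ y ⌋))) ⟩
  ∑[ y < n ] (𝟙 (c y) ℕ.* countFin (λ z → c z ∧ not ⌊ z ≟ᶠ y ⌋))
    ≡⟨ sum-cong-≗ others ⟩
  ∑[ y < n ] (𝟙 (c y) ℕ.* (countFin c ∸ 1))
    ≡⟨ sym (*-distribʳ-sum (countFin c ∸ 1) (𝟙 ∘ c)) ⟩
  (∑[ y < n ] 𝟙 (c y)) ℕ.* (countFin c ∸ 1)
    ≡⟨ cong (ℕ._* (countFin c ∸ 1)) (sym (countFin≡∑𝟙 c)) ⟩
  pairs (countFin c) ∎)
  where
  open ≡-Reasoning
  others : ∀ y → 𝟙 (c y) ℕ.* countFin (λ z → c z ∧ not ⌊ z ≟ᶠ y ⌋) ≡ 𝟙 (c y) ℕ.* (countFin c ∸ 1)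
  others y with c y in cy
  ... | false = refl
  ... | true  = cong (λ k → 1 ℕ.* (k ∸ 1)) (sym (countFin-remove {p = c} (subst T (sym cy) _)))

∑-pairs : ∀ {n} (p : Fin n → Bool) (r : Fin n → Fin n → Bool) →
  ∑[ x < n ] (𝟙 (p x) ℕ.* pairs (countFin (r x)))
    ≡ ∑[ y < n ] ∑[ z < n ] countFin (λ x → p x ∧ (r x y ∧ (r x z ∧ not ⌊ z ≟ᶠ y ⌋)))
∑-pairs {n} p r = begin
  ∑[ x < n ] (𝟙 (p x) ℕ.* pairs (countFin (r x)))
    ≡⟨ sum-cong-≗ (λ x → cong (𝟙 (p x) ℕ.*_) (pairs-countFin (r x))) ⟩
  ∑[ x < n ] (𝟙 (p x) ℕ.* ∑[ y < n ] countFin (λ z → F x y z))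
    ≡⟨ sum-cong-≗ (λ x → trans (*-distribˡ-sum (𝟙 (p x)) (λ y → countFin (F x y)))
                                (sum-cong-≗ (λ y → 𝟙*countFin (p x) (F x y)))) ⟩
  ∑[ x < n ] ∑[ y < n ] countFin (λ z → p x ∧ F x y z)
    ≡⟨ sum-cong-≗ (λ x → sum-cong-≗ (λ y → countFin≡∑𝟙 (λ z → p x ∧ F x y z))) ⟩
  ∑[ x < n ] ∑[ y < n ] ∑[ z < n ] 𝟙 (p x ∧ F x y z)
    ≡⟨ ∑-comm (λ x y → ∑[ z < n ] 𝟙 (p x ∧ F x y z)) ⟩
  ∑[ y < n ] ∑[ x < n ] ∑[ z < n ] 𝟙 (p x ∧ F x y z)
    ≡⟨ sum-cong-≗ (λ y → ∑-comm (λ x z → 𝟙 (p x ∧ F x y z))) ⟩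
  ∑[ y < n ] ∑[ z < n ] ∑[ x < n ] 𝟙 (p x ∧ F x y z)
    ≡⟨ sum-cong-≗ (λ y → sum-cong-≗ (λ z → sym (countFin≡∑𝟙 (λ x → p x ∧ F x y z)))) ⟩
  ∑[ y < n ] ∑[ z < n ] countFin (λ x → p x ∧ F x y z) ∎
  where
  open ≡-Reasoning
  F : Fin n → Fin n → Fin n → Bool
  F x y z = r x y ∧ (r x z ∧ not ⌊ z ≟ᶠ y ⌋)

∑-δ : ∀ {N} m (h : ℕ → ℕ) → m ℕ.< N → ∑[ k < N ] (𝟙 (m ≡ᵇ toℕ k) ℕ.* h (toℕ k)) ≡ h m
∑-δ {suc N} zero    h _ =
  trans (cong₂ ℕ._+_ (ℕ.+-identityʳ (h 0)) (sum-replicate-zero N)) (ℕ.+-identityʳ (h 0))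
∑-δ {suc N} (suc m) h (s≤s m<N) = ∑-δ m (h ∘ suc) m<N

∑-fibres : ∀ {n N} (p : Fin n → Bool) (g : Fin n → ℕ) (h : ℕ → ℕ) → (∀ x → g x ℕ.< N) →
  ∑[ x < n ] (𝟙 (p x) ℕ.* h (g x)) ≡ ∑[ k < N ] (countFin (λ x → p x ∧ (g x ≡ᵇ toℕ k)) ℕ.* h (toℕ k))
∑-fibres {n} {N} p g h g<N = sym (begin
  ∑[ k < N ] (countFin (λ x → p x ∧ (g x ≡ᵇ toℕ k)) ℕ.* h (toℕ k))
    ≡⟨ sum-cong-≗ (λ k → trans (cong (ℕ._* h (toℕ k)) (countFin≡∑𝟙 (fibre k)))
                                (*-distribʳ-sum {n} (h (toℕ k)) (𝟙 ∘ fibre k))) ⟩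
  ∑[ k < N ] ∑[ x < n ] (𝟙 (p x ∧ (g x ≡ᵇ toℕ k)) ℕ.* h (toℕ k))
    ≡⟨ ∑-comm {N} {n} (λ k x → 𝟙 (fibre k x) ℕ.* h (toℕ k)) ⟩
  ∑[ x < n ] ∑[ k < N ] (𝟙 (p x ∧ (g x ≡ᵇ toℕ k)) ℕ.* h (toℕ k))
    ≡⟨ sum-cong-≗ (λ x → trans (sum-cong-≗ {N} (λ k → 𝟙-∧-* (p x) (g x ≡ᵇ toℕ k) (h (toℕ k))))
                                (sym (*-distribˡ-sum {N} (𝟙 (p x)) (δ x)))) ⟩
  ∑[ x < n ] (𝟙 (p x) ℕ.* ∑[ k < N ] δ x k)
    ≡⟨ sum-cong-≗ (λ x → cong (𝟙 (p x) ℕ.*_) (∑-δ (g x) h (g<N x))) ⟩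
  ∑[ x < n ] (𝟙 (p x) ℕ.* h (g x)) ∎)
  where
  open ≡-Reasoning
  fibre : Fin N → Fin n → Bool
  fibre k x = p x ∧ (g x ≡ᵇ toℕ k)
  δ : Fin n → Fin N → ℕ
  δ x k = 𝟙 (g x ≡ᵇ toℕ k) ℕ.* h (toℕ k)
  𝟙-∧-* : ∀ a b c → 𝟙 (a ∧ b) ℕ.* c ≡ 𝟙 a ℕ.* (𝟙 b ℕ.* c)
  𝟙-∧-* false b c = refl
  𝟙-∧-* true  b c = sym (ℕ.+-identityʳ (𝟙 b ℕ.* c))

fibres-dominated⇒≡ : ∀ {n} N (p : Fin n → Bool) (g₁ g₂ : Fin n → ℕ) →
  (∀ x → g₁ x ℕ.< N) → (∀ x → g₂ x ℕ.< N) →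
  (∀ k → countFin (λ x → p x ∧ (g₁ x ≡ᵇ k)) ℕ.≤ countFin (λ x → p x ∧ (g₂ x ≡ᵇ k))) →
  ∀ k → k ℕ.< N → countFin (λ x → p x ∧ (g₁ x ≡ᵇ k)) ≡ countFin (λ x → p x ∧ (g₂ x ≡ᵇ k))
fibres-dominated⇒≡ N p g₁ g₂ g₁<N g₂<N dominated k k<N =
  subst (λ j → fibre g₁ j ≡ fibre g₂ j) (toℕ-fromℕ< k<N)
    (ℕ.*-cancelʳ-≡ _ _ 1 (∑≡∑⇒≗ (λ j → ℕ.*-monoˡ-≤ 1 (dominated (toℕ j)))
      (trans (sym (∑-fibres p g₁ (λ _ → 1) g₁<N)) (∑-fibres p g₂ (λ _ → 1) g₂<N)) (Fin.fromℕ< k<N)))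
  where
  fibre : (Fin _ → ℕ) → ℕ → ℕ
  fibre g j = countFin (λ x → p x ∧ (g x ≡ᵇ j))

∑ᶻ-snoc : ∀ N (f : ℕ → ℤ) → ℤΣ.sum {suc N} (f ∘ toℕ) ≡ ℤΣ.sum {N} (f ∘ toℕ) + f N
∑ᶻ-snoc N f = trans (ℤΣ.sum-init-last {N} (f ∘ toℕ))
  (cong₂ _+_ (ℤΣ.sum-cong-≗ {N} (cong f ∘ toℕ-inject₁)) (cong f (toℕ-fromℕ N)))

eval1≡∑coeff : ∀ D m → length D ℕ.≤ m → eval1 D ≡ ℤΣ.sum {m} (coeff D ∘ toℕ)
eval1≡∑coeff []      m       _       = sym (ℤΣ.sum-replicate-zero m)
eval1≡∑coeff (a ∷ D) (suc m) (s≤s h) = cong (_+_ a) (eval1≡∑coeff D m h)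

coeff-beyond-length : ∀ D m → length D ℕ.≤ m → coeff D m ≡ + 0
coeff-beyond-length []      m       _       = refl
coeff-beyond-length (a ∷ D) (suc m) (s≤s h) = coeff-beyond-length D m h

∑ᶻ-difference : ∀ {N} (f g : Fin N → ℕ) →
  ℤΣ.sum (λ i → + f i - + g i) ≡ + (∑[ i < N ] f i) - + (∑[ i < N ] g i)
∑ᶻ-difference {zero}  f g = refl
∑ᶻ-difference {suc N} f g = begin
  (+ f zero - + g zero) + ℤΣ.sum (λ i → + f (suc i) - + g (suc i))
    ≡⟨ cong (_+_ (+ f zero - + g zero)) (∑ᶻ-difference (f ∘ suc) (g ∘ suc)) ⟩
  (+ f zero - + g zero) + (+ ∑f′ - + ∑g′)
    ≡⟨ regroup (+ f zero) (+ g zero) (+ ∑f′) (+ ∑g′) ⟩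
  (+ f zero + + ∑f′) - (+ g zero + + ∑g′)
    ≡⟨ sym (cong₂ _-_ (ℤ.pos-+ (f zero) ∑f′) (ℤ.pos-+ (g zero) ∑g′)) ⟩
  + (f zero ℕ.+ ∑f′) - + (g zero ℕ.+ ∑g′) ∎
  where
  open ≡-Reasoning
  ∑f′ = ∑[ i < N ] f (suc i)
  ∑g′ = ∑[ i < N ] g (suc i)
  regroup : ∀ a b c d → (a - b) + (c - d) ≡ (a + c) - (b + d)
  regroup = solve-∀

+*-difference : ∀ a b c → + a * (+ b - + c) ≡ + (b ℕ.* a) - + (c ℕ.* a)
+*-difference a b c = trans (distrib (+ a) (+ b) (+ c)) (sym (cong₂ _-_ (ℤ.pos-* b a) (ℤ.pos-* c a)))
  where
  distrib : ∀ a b c → a * (b - c) ≡ b * a - c * a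
  distrib = solve-∀

-- F″(1) for the polynomial F = (q - 1)² D, truncated below degree N.
secondMoment : Poly → ℕ → ℤ
secondMoment D N = ℤΣ.sum {N} (λ k → + pairs (toℕ k) * sqMul-coeff D (toℕ k))

secondMoment-sqMul : ∀ D m → secondMoment D (2 ℕ.+ m) ≡
  + 2 * ℤΣ.sum {m} (coeff D ∘ toℕ) - + m * (+ m + + 3) * coeff D m + (+ m + + 1) * + m * coeff D (suc m)
secondMoment-sqMul D zero    = base (coeff D 0) (coeff D 1)
  where
  base : ∀ d₀ d₁ → (+ 0 + + 0 * d₀) + + 0 * (d₁ - + 2 * d₀)
                 ≡ + 2 * + 0 - + 0 * (+ 0 + + 3) * d₀ + (+ 0 + + 1) * + 0 * d₁
  base = solve-∀
secondMoment-sqMul D (suc m) = begin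
  secondMoment D (3 ℕ.+ m)
    ≡⟨ ∑ᶻ-snoc (2 ℕ.+ m) (λ k → + pairs k * sqMul-coeff D k) ⟩
  secondMoment D (2 ℕ.+ m) + + pairs (2 ℕ.+ m) * sqMul-coeff D (2 ℕ.+ m)
    ≡⟨ cong₂ _+_ (secondMoment-sqMul D m) (cong (_* sqMul-coeff D (2 ℕ.+ m)) +pairs) ⟩
  (+ 2 * s - M * (M + + 3) * d₀ + (M + + 1) * M * d₁) + (+ 2 + M) * (+ 1 + M) * ((d₂ - + 2 * d₁) + d₀)
    ≡⟨ step s M d₀ d₁ d₂ ⟩
  + 2 * (s + d₀) - (+ 1 + M) * ((+ 1 + M) + + 3) * d₁ + ((+ 1 + M) + + 1) * (+ 1 + M) * d₂
    ≡⟨ cong₂ (λ s′ M′ → + 2 * s′ - M′ * (M′ + + 3) * d₁ + (M′ + + 1) * M′ * d₂)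
             (sym (∑ᶻ-snoc m (coeff D))) (sym (ℤ.pos-+ 1 m)) ⟩
  + 2 * ℤΣ.sum {suc m} (coeff D ∘ toℕ) - + suc m * (+ suc m + + 3) * d₁ + (+ suc m + + 1) * + suc m * d₂ ∎
  where
  open ≡-Reasoning
  s = ℤΣ.sum {m} (coeff D ∘ toℕ)
  M = + m
  d₀ = coeff D m
  d₁ = coeff D (suc m)
  d₂ = coeff D (2 ℕ.+ m)
  +pairs : + pairs (2 ℕ.+ m) ≡ (+ 2 + + m) * (+ 1 + + m)
  +pairs = trans (ℤ.pos-* (2 ℕ.+ m) (1 ℕ.+ m)) (cong₂ _*_ (ℤ.pos-+ 2 m) (ℤ.pos-+ 1 m))
  step : ∀ s M d₀ d₁ d₂ →
    (+ 2 * s - M * (M + + 3) * d₀ + (M + + 1) * M * d₁) + (+ 2 + M) * (+ 1 + M) * ((d₂ - + 2 * d₁) + d₀)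
      ≡ + 2 * (s + d₀) - (+ 1 + M) * ((+ 1 + M) + + 3) * d₁ + ((+ 1 + M) + + 1) * (+ 1 + M) * d₂
  step = solve-∀

secondMoment-sqMul≡2*eval1 : ∀ D m → length D ℕ.≤ m → secondMoment D (2 ℕ.+ m) ≡ + 2 * eval1 D
secondMoment-sqMul≡2*eval1 D m len≤m = begin
  secondMoment D (2 ℕ.+ m)
    ≡⟨ secondMoment-sqMul D m ⟩
  + 2 * ℤΣ.sum {m} (coeff D ∘ toℕ) - + m * (+ m + + 3) * coeff D m + (+ m + + 1) * + m * coeff D (suc m)
    ≡⟨ cong₂ (λ a b → + 2 * ℤΣ.sum {m} (coeff D ∘ toℕ) - + m * (+ m + + 3) * a + (+ m + + 1) * + m * b)
             (coeff-beyond-length D m len≤m) (coeff-beyond-length D (suc m) (ℕ.m≤n⇒m≤1+n len≤m)) ⟩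
  + 2 * ℤΣ.sum {m} (coeff D ∘ toℕ) - + m * (+ m + + 3) * + 0 + (+ m + + 1) * + m * + 0
    ≡⟨ vanish (ℤΣ.sum {m} (coeff D ∘ toℕ)) (+ m) ⟩
  + 2 * ℤΣ.sum {m} (coeff D ∘ toℕ)
    ≡⟨ cong (_*_ (+ 2)) (sym (eval1≡∑coeff D m len≤m)) ⟩
  + 2 * eval1 D ∎
  where
  open ≡-Reasoning
  vanish : ∀ s M → + 2 * s - M * (M + + 3) * + 0 + (M + + 1) * M * + 0 ≡ + 2 * s
  vanish = solve-∀

sqMul-coeff≡0⇒IsZeroPoly : ∀ D → (∀ k → sqMul-coeff D k ≡ + 0) → IsZeroPoly D
sqMul-coeff≡0⇒IsZeroPoly D c≡0 k = proj₁ (consecutive k)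
  where
  d = coeff D
  consecutive : ∀ k → d k ≡ + 0 × d (suc k) ≡ + 0
  consecutive zero = c≡0 0 , (begin
    d 1                     ≡⟨ sym (ℤ.+-identityʳ (d 1)) ⟩
    d 1 - + 2 * + 0         ≡⟨ cong (λ d₀ → d 1 - + 2 * d₀) (sym (c≡0 0)) ⟩
    sqMul-coeff D 1         ≡⟨ c≡0 1 ⟩
    + 0                     ∎)
    where open ≡-Reasoning
  consecutive (suc k) with consecutive k
  ... | dₖ≡0 , dₖ₊₁≡0 = dₖ₊₁≡0 , (begin
    d (2 ℕ.+ k)
      ≡⟨ sym (trans (ℤ.+-identityʳ _) (ℤ.+-identityʳ _)) ⟩
    (d (2 ℕ.+ k) - + 2 * + 0) + + 0
      ≡⟨ cong₂ (λ d₁ d₀ → (d (2 ℕ.+ k) - + 2 * d₁) + d₀) (sym dₖ₊₁≡0) (sym dₖ≡0) ⟩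
    sqMul-coeff D (2 ℕ.+ k)
      ≡⟨ c≡0 (2 ℕ.+ k) ⟩
    + 0 ∎)
    where open ≡-Reasoning

IsZeroPoly⇒eval1≡0 : ∀ D → IsZeroPoly D → eval1 D ≡ + 0
IsZeroPoly⇒eval1≡0 []      _   = refl
IsZeroPoly⇒eval1≡0 (a ∷ D) D≡0 = cong₂ _+_ (D≡0 0) (IsZeroPoly⇒eval1≡0 D (D≡0 ∘ suc))

module FinitePoset {n ℓ} {_≼_ : Rel (Fin n) ℓ}
  (isPartialOrder : IsPartialOrder _≡_ _≼_) (_≼?_ : Decidable _≼_) where

  open IsPartialOrder isPartialOrder using (antisym) renaming (refl to ≼-refl; trans to ≼-trans)
  open import Relation.Binary.Construct.NonStrictToStrict _≡_ _≼_ public using () renaming (_<_ to _≺_)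
  open import Relation.Binary.Construct.NonStrictToStrict _≡_ _≼_
    using (<-decidable; <⇒≱; <-≤-trans; ≤-<-trans)

  _≺?_ : Decidable _≺_
  _≺?_ = <-decidable _≟ᶠ_ _≼?_

  ≺⇒⋡ : ∀ {x y} → x ≺ y → ¬ y ≼ x
  ≺⇒⋡ = <⇒≱ antisym

  ≺-≼-trans : ∀ {x y z} → x ≺ y → y ≼ z → x ≺ z
  ≺-≼-trans = <-≤-trans sym ≼-trans antisym (subst (_ ≼_))

  ≼-≺-trans : ∀ {x y z} → x ≼ y → y ≺ z → x ≺ z
  ≼-≺-trans = ≤-<-trans ≼-trans antisym (subst (_≼ _))

  ≼∧⊀⇒≡ : ∀ {x y} → x ≼ y → ¬ x ≺ y → x ≡ y
  ≼∧⊀⇒≡ {x} {y} x≼y x⊀y = decidable-stable (x ≟ᶠ y) (λ x≢y → x⊀y (x≼y , x≢y))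

  Minimal Maximal : ∀ {q} → Pred (Fin n) q → Pred (Fin n) (ℓ ⊔ q)
  Minimal Q m = Q m × (∀ t → Q t → ¬ t ≺ m)
  Maximal Q m = Q m × (∀ t → Q t → ¬ m ≺ t)

  module _ {q} {Q : Pred (Fin n) q} (Q? : U.Decidable Q) where

    minimal? : U.Decidable (Minimal Q)
    minimal? m = Q? m ×-dec all? (λ t → Q? t →-dec ¬? (t ≺? m))

    maximal? : U.Decidable (Maximal Q)
    maximal? m = Q? m ×-dec all? (λ t → Q? t →-dec ¬? (m ≺? t))

    minimal-below : ∀ {x} → Q x → ∃ λ m → m ≼ x × Minimal Q m
    minimal-below = All.wfRec (po-wellFounded isPartialOrder) _ Goal step _
      where
      Goal : Pred (Fin n) (ℓ ⊔ q)
      Goal x = Q x → ∃ λ m → m ≼ x × Minimal Q m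
      step : ∀ x → WfRec _≺_ Goal x → Goal x
      step x rec Qx with any? (λ t → Q? t ×-dec (t ≺? x))
      ... | yes (t , Qt , t≺x) = let m , m≼t , min = rec t≺x Qt in m , ≼-trans m≼t (proj₁ t≺x) , min
      ... | no  ∄t             = x , ≼-refl , Qx , λ t Qt t≺x → ∄t (t , Qt , t≺x)

    maximal-above : ∀ {x} → Q x → ∃ λ m → x ≼ m × Maximal Q m
    maximal-above = All.wfRec (po-noetherian isPartialOrder) _ Goal step _
      where
      Goal : Pred (Fin n) (ℓ ⊔ q)
      Goal x = Q x → ∃ λ m → x ≼ m × Maximal Q m
      step : ∀ x → WfRec (flip _≺_) Goal x → Goal x
      step x rec Qx with any? (λ t → Q? t ×-dec (x ≺? t))
      ... | yes (t , Qt , x≺t) = let m , t≼m , max = rec x≺t Qt in m , ≼-trans (proj₁ x≺t) t≼m , max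
      ... | no  ∄t             = x , ≼-refl , Qx , λ t Qt x≺t → ∄t (t , Qt , x≺t)

module FinDistributiveLattice {n} (le : Fin n → Fin n → Bool) {_⊔_ _⊓_ : Fin n → Fin n → Fin n}
  (isDistributiveLattice : IsDistributiveLattice _≡_ (λ x y → T (le x y)) _⊔_ _⊓_) where

  infix 4 _≼_ _≼?_ _⋖_ _⋖?_

  _≼_ : Rel (Fin n) 0ℓ
  x ≼ y = T (le x y)

  _≼?_ : Decidable _≼_
  x ≼? y = T? (le x y)

  open IsDistributiveLattice isDistributiveLattice public
    using (isPartialOrder; antisym; x≤x∨y; y≤x∨y; ∨-least; x∧y≤x; x∧y≤y; ∧-greatest; ∧-distribˡ-∨)
    renaming (refl to ≼-refl; trans to ≼-trans)

  open FinitePoset isPartialOrder _≼?_ public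

  private
    lattice : DistributiveLattice 0ℓ 0ℓ 0ℓ
    lattice = record { isDistributiveLattice = isDistributiveLattice }
    open DistributiveLattice lattice using (joinSemilattice; meetSemilattice)

  open import Relation.Binary.Lattice.Properties.JoinSemilattice joinSemilattice public
    using (x≤y⇒x∨y≈y; ∨-comm)
  open import Relation.Binary.Lattice.Properties.MeetSemilattice meetSemilattice public
    using (y≤x⇒x∧y≈y; ∧-comm)

  ⋠⇒⊓≺ : ∀ {x y} → ¬ x ≼ y → x ⊓ y ≺ x
  ⋠⇒⊓≺ {x} {y} x⋠y = x∧y≤x x y , λ x⊓y≡x → x⋠y (subst (_≼ y) x⊓y≡x (x∧y≤y x y))

  ⋠⇒≺⊔ : ∀ {x y} → ¬ y ≼ x → x ≺ x ⊔ y
  ⋠⇒≺⊔ {x} {y} y⋠x = x≤x∨y x y , λ x≡x⊔y → y⋠x (subst (y ≼_) (sym x≡x⊔y) (y≤x∨y x y))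

  Maximal-⊔-closed⇒greatest : ∀ {q} {Q : Pred (Fin n) q} → (∀ {a b} → Q a → Q b → Q (a ⊔ b)) →
                              ∀ {m t} → Maximal Q m → Q t → t ≼ m
  Maximal-⊔-closed⇒greatest ⊔-closed {m} {t} (Qm , max) Qt =
    subst (t ≼_) (sym (≼∧⊀⇒≡ (y≤x∨y t m) (max (t ⊔ m) (⊔-closed Qt Qm)))) (x≤x∨y t m)

  Minimal-⊓-closed⇒least : ∀ {q} {Q : Pred (Fin n) q} → (∀ {a b} → Q a → Q b → Q (a ⊓ b)) →
                           ∀ {m t} → Minimal Q m → Q t → m ≼ t
  Minimal-⊓-closed⇒least ⊓-closed {m} {t} (Qm , min) Qt =
    subst (_≼ t) (≼∧⊀⇒≡ (x∧y≤x m t) (min (m ⊓ t) (⊓-closed Qm Qt))) (x∧y≤y m t)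

  ⊓-⊔-absorb : ∀ {a y z} → y ≼ a → a ⊓ z ≼ y → a ⊓ (y ⊔ z) ≡ y
  ⊓-⊔-absorb {a} {y} {z} y≼a a⊓z≼y = begin
    a ⊓ (y ⊔ z)         ≡⟨ ∧-distribˡ-∨ a y z ⟩
    (a ⊓ y) ⊔ (a ⊓ z)   ≡⟨ cong (_⊔ (a ⊓ z)) (y≤x⇒x∧y≈y y≼a) ⟩
    y ⊔ (a ⊓ z)         ≡⟨ ∨-comm y (a ⊓ z) ⟩
    (a ⊓ z) ⊔ y         ≡⟨ x≤y⇒x∨y≈y a⊓z≼y ⟩
    y                   ∎
    where open ≡-Reasoning

  ⊔-absorb : ∀ {a b c} → c ≼ a ⊔ b → (a ⊔ c) ⊔ b ≡ a ⊔ b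
  ⊔-absorb {a} {b} {c} c≼a⊔b = antisym (∨-least (∨-least (x≤x∨y a b) c≼a⊔b) (y≤x∨y a b))
                                       (∨-least (≼-trans (x≤x∨y a c) (x≤x∨y (a ⊔ c) b)) (y≤x∨y (a ⊔ c) b))

  ∃-bottom : Fin n → ∃ λ ⊥ → ∀ t → ⊥ ≼ t
  ∃-bottom x = let ⊥ , _ , minimal = minimal-below U? {x} _ in
    ⊥ , λ t → Minimal-⊓-closed⇒least {Q = U.U} _ minimal _

  _⋖_ : Rel (Fin n) 0ℓ
  y ⋖ x = y ≺ x × (∀ z → y ≺ z → ¬ z ≺ x)

  _⋖?_ : Decidable _⋖_
  y ⋖? x = (y ≺? x) ×-dec all? (λ z → (y ≺? z) →-dec ¬? (z ≺? x))

  ⋖-squeeze : ∀ {x y w} → y ⋖ x → y ≺ w → w ≼ x → w ≡ x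
  ⋖-squeeze (_ , nothing-between) y≺w w≼x = ≼∧⊀⇒≡ w≼x (nothing-between _ y≺w)

  ⋖-join : ∀ {x y z} → y ⋖ x → z ⋖ x → y ≢ z → y ⊔ z ≡ x
  ⋖-join {x} {y} {z} y⋖x z⋖x y≢z =
    ⋖-squeeze y⋖x (⋠⇒≺⊔ z⋠y) (∨-least (proj₁ (proj₁ y⋖x)) (proj₁ (proj₁ z⋖x)))
    where
    z⋠y : ¬ z ≼ y
    z⋠y z≼y = proj₂ z⋖x y (z≼y , y≢z ∘ sym) (proj₁ y⋖x)

  ⋖-meet : ∀ {x y z} → y ⋖ x → z ⋖ x → y ≢ z → y ⊓ z ⋖ y
  ⋖-meet {x} {y} {z} y⋖x z⋖x y≢z = ⋠⇒⊓≺ y⋠z , nothing-between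
    where
    y⋠z : ¬ y ≼ z
    y⋠z y≼z = proj₂ y⋖x z (y≼z , y≢z) (proj₁ z⋖x)
    nothing-between : ∀ t → y ⊓ z ≺ t → ¬ t ≺ y
    nothing-between t y⊓z≺t t≺y with z ≟ᶠ t ⊔ z
    ... | yes z≡t⊔z = ≺⇒⋡ y⊓z≺t (∧-greatest (proj₁ t≺y) (subst (t ≼_) (sym z≡t⊔z) (x≤x∨y t z)))
    ... | no  z≢t⊔z = proj₂ t≺y (sym (begin
      y                   ≡⟨ sym (trans (∧-comm y x) (y≤x⇒x∧y≈y (proj₁ (proj₁ y⋖x)))) ⟩
      y ⊓ x               ≡⟨ cong (y ⊓_) (sym t⊔z≡x) ⟩
      y ⊓ (t ⊔ z)         ≡⟨ ∧-distribˡ-∨ y t z ⟩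
      (y ⊓ t) ⊔ (y ⊓ z)   ≡⟨ cong (_⊔ (y ⊓ z)) (y≤x⇒x∧y≈y (proj₁ t≺y)) ⟩
      t ⊔ (y ⊓ z)         ≡⟨ ∨-comm t (y ⊓ z) ⟩
      (y ⊓ z) ⊔ t         ≡⟨ x≤y⇒x∨y≈y (proj₁ y⊓z≺t) ⟩
      t                   ∎))
      where
      open ≡-Reasoning
      t⊔z≡x : t ⊔ z ≡ x
      t⊔z≡x = ⋖-squeeze z⋖x (y≤x∨y t z , z≢t⊔z)
                (∨-least (≼-trans (proj₁ t≺y) (proj₁ (proj₁ y⋖x))) (proj₁ (proj₁ z⋖x)))

  ≺⇒∃⋖ : ∀ {w a} → w ≺ a → ∃ λ y → w ⋖ y × y ≼ a
  ≺⇒∃⋖ {w} {a} w≺a =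
    let y , _ , (w≺y , y≼a) , min = minimal-below (λ y → (w ≺? y) ×-dec (y ≼? a)) (w≺a , ≼-refl)
    in y , (w≺y , λ z w≺z z≺y → min z (w≺z , ≼-trans (proj₁ z≺y) y≼a) z≺y) , y≼a

  -- The first component says that j is not a least element; no bottom is assumed to exist.
  JoinPrime : Pred (Fin n) 0ℓ
  JoinPrime j = (∃ λ y → ¬ j ≼ y) × (∀ a b → j ≼ a ⊔ b → j ≼ a ⊎ j ≼ b)

  joinPrime? : U.Decidable JoinPrime
  joinPrime? j = any? (λ y → ¬? (j ≼? y))
           ×-dec all? (λ a → all? (λ b → (j ≼? a ⊔ b) →-dec ((j ≼? a) ⊎-dec (j ≼? b))))

  -- If i lay below a ⊔ b but neither a nor b, distributivity would write it as the join
  -- i ⊓ a ⊔ i ⊓ b of two strictly smaller elements, both of which minimality puts below y.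
  minimal⇒joinPrime : ∀ {x y i} → Minimal (λ t → t ≼ x × ¬ t ≼ y) i → JoinPrime i
  minimal⇒joinPrime {x} {y} {i} ((i≼x , i⋠y) , min) = (y , i⋠y) , prime
    where
    meet≼y : ∀ c → ¬ i ≼ c → i ⊓ c ≼ y
    meet≼y c i⋠c = decidable-stable (i ⊓ c ≼? y)
      (λ i⊓c⋠y → min (i ⊓ c) (≼-trans (x∧y≤x i c) i≼x , i⊓c⋠y) (⋠⇒⊓≺ i⋠c))
    prime : ∀ a b → i ≼ a ⊔ b → i ≼ a ⊎ i ≼ b
    prime a b i≼a⊔b with i ≼? a | i ≼? b
    ... | yes i≼a | _       = inj₁ i≼a
    ... | no  _   | yes i≼b = inj₂ i≼b
    ... | no  i⋠a | no  i⋠b =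
      contradiction (subst (_≼ y) i⊓a⊔i⊓b≡i (∨-least (meet≼y a i⋠a) (meet≼y b i⋠b))) i⋠y
      where
      i⊓a⊔i⊓b≡i : (i ⊓ a) ⊔ (i ⊓ b) ≡ i
      i⊓a⊔i⊓b≡i = trans (sym (∧-distribˡ-∨ i a b)) (trans (∧-comm i (a ⊔ b)) (y≤x⇒x∧y≈y i≼a⊔b))

  ⋠⇒∃joinPrime : ∀ {x y} → ¬ x ≼ y → ∃ λ i → JoinPrime i × i ≼ x × ¬ i ≼ y
  ⋠⇒∃joinPrime {x} {y} x⋠y =
    let i , _ , minimal = minimal-below (λ t → (t ≼? x) ×-dec ¬? (t ≼? y)) (≼-refl , x⋠y)
    in i , minimal⇒joinPrime minimal , proj₁ minimal

  ≼-byJoinPrimes : ∀ {x y} → (∀ i → JoinPrime i → i ≼ x → i ≼ y) → x ≼ y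
  ≼-byJoinPrimes {x} {y} below = decidable-stable (x ≼? y) λ x⋠y →
    let i , jp , i≼x , i⋠y = ⋠⇒∃joinPrime x⋠y in i⋠y (below i jp i≼x)

  JoinPrimeBelow : Fin n → Pred (Fin n) 0ℓ
  JoinPrimeBelow x i = JoinPrime i × i ≼ x

  joinPrimeBelow? : ∀ x → U.Decidable (JoinPrimeBelow x)
  joinPrimeBelow? x i = joinPrime? i ×-dec (i ≼? x)

  label : ∀ {x y} → y ⋖ x → ∃ λ i → JoinPrime i × i ≼ x × ¬ i ≼ y
  label y⋖x = ⋠⇒∃joinPrime (≺⇒⋡ (proj₁ y⋖x))

  label-unique : ∀ {x y i j} → y ⋖ x → JoinPrimeBelow x i → JoinPrimeBelow x j →
                 ¬ i ≼ y → ¬ j ≼ y → i ≡ j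
  label-unique {x} {y} y⋖x (jpᵢ , i≼x) (jpⱼ , j≼x) i⋠y j⋠y =
    antisym (below jpᵢ i≼x j≼x i⋠y j⋠y) (below jpⱼ j≼x i≼x j⋠y i⋠y)
    where
    below : ∀ {a b} → JoinPrime a → a ≼ x → b ≼ x → ¬ a ≼ y → ¬ b ≼ y → a ≼ b
    below {a} {b} (_ , prime) a≼x b≼x a⋠y b⋠y = case prime y b (subst (a ≼_) (sym y⊔b≡x) a≼x) of λ where
        (inj₁ a≼y) → contradiction a≼y a⋠y
        (inj₂ a≼b) → a≼b
      where
      y⊔b≡x : y ⊔ b ≡ x
      y⊔b≡x = ⋖-squeeze y⋖x (⋠⇒≺⊔ b⋠y) (∨-least (proj₁ (proj₁ y⋖x)) b≼x)

  label-maximal : ∀ {x y} (y⋖x : y ⋖ x) → Maximal (JoinPrimeBelow x) (proj₁ (label y⋖x))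
  label-maximal {x} {y} y⋖x = (jpᵢ , i≼x) , λ k (jpₖ , k≼x) i≺k →
    proj₂ i≺k (label-unique y⋖x (jpᵢ , i≼x) (jpₖ , k≼x) i⋠y
                            (λ k≼y → i⋠y (≼-trans (proj₁ i≺k) k≼y)))
    where
    i = proj₁ (label y⋖x)
    jpᵢ = proj₁ (proj₂ (label y⋖x))
    i≼x = proj₁ (proj₂ (proj₂ (label y⋖x)))
    i⋠y = proj₂ (proj₂ (proj₂ (label y⋖x)))

  -- The greatest element below x avoiding j; it exists because these elements are closed
  -- under ⊔, j being join-prime.
  maximalJoinPrime⇒lowerCover : ∀ {x j} → Maximal (JoinPrimeBelow x) j → ∃ λ d → d ⋖ x × ¬ j ≼ d
  maximalJoinPrime⇒lowerCover {x} {j} ((((y₀ , j⋠y₀) , prime) , j≼x) , maxⱼ) =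
    d , ((d≼x , λ d≡x → j⋠d (subst (j ≼_) (sym d≡x) j≼x)) , nothing-between) , j⋠d
    where
    Avoid : Pred (Fin n) 0ℓ
    Avoid t = t ≼ x × ¬ j ≼ t
    avoid-⊔-closed : ∀ {a b} → Avoid a → Avoid b → Avoid (a ⊔ b)
    avoid-⊔-closed (a≼x , j⋠a) (b≼x , j⋠b) = ∨-least a≼x b≼x , λ j≼a⊔b →
      case prime _ _ j≼a⊔b of λ where
      (inj₁ j≼a) → j⋠a j≼a
      (inj₂ j≼b) → j⋠b j≼b
    start : Avoid (x ⊓ y₀)
    start = x∧y≤x x y₀ , λ j≼x⊓y₀ → j⋠y₀ (≼-trans j≼x⊓y₀ (x∧y≤y x y₀))
    greatest = maximal-above (λ t → (t ≼? x) ×-dec ¬? (j ≼? t)) start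
    d = proj₁ greatest
    d≼x = proj₁ (proj₁ (proj₂ (proj₂ greatest)))
    j⋠d = proj₂ (proj₁ (proj₂ (proj₂ greatest)))
    below-d : ∀ {t} → Avoid t → t ≼ d
    below-d = Maximal-⊔-closed⇒greatest avoid-⊔-closed (proj₂ (proj₂ greatest))
    nothing-between : ∀ z → d ≺ z → ¬ z ≺ x
    nothing-between z d≺z z≺x = ≺⇒⋡ z≺x (≼-byJoinPrimes below-z)
      where
      j≼z : j ≼ z
      j≼z = decidable-stable (j ≼? z) (λ j⋠z → ≺⇒⋡ d≺z (below-d (proj₁ z≺x , j⋠z)))
      below-z : ∀ i → JoinPrime i → i ≼ x → i ≼ z
      below-z i jpᵢ i≼x with j ≼? i
      ... | yes j≼i = subst (_≼ z) (≼∧⊀⇒≡ j≼i (maxⱼ i (jpᵢ , i≼x))) j≼z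
      ... | no  j⋠i = ≼-trans (below-d (i≼x , j⋠i)) (proj₁ d≺z)

  #lowerCovers≡#maximalJoinPrimes : ∀ x →
    countFin (λ y → ⌊ y ⋖? x ⌋) ≡ countFin (λ j → ⌊ maximal? (joinPrimeBelow? x) j ⌋)
  #lowerCovers≡#maximalJoinPrimes x =
    ℕ.≤-antisym
      (countFin-injection labelOf (λ _ y⋖x → fromWitness (label-maximal (toWitness y⋖x))) labelOf-injective)
      (countFin-injection dropOf dropOf-covered dropOf-injective)
    where
    labelOf : ∀ y → T ⌊ y ⋖? x ⌋ → Fin n
    labelOf y y⋖x = proj₁ (label (toWitness y⋖x))
    labelOf-injective : ∀ {y y′} y⋖x y′⋖x → labelOf y y⋖x ≡ labelOf y′ y′⋖x → y ≡ y′
    labelOf-injective {y} {y′} y⋖x y′⋖x i≡i′ = decidable-stable (y ≟ᶠ y′) λ y≢y′ →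
      let i , jp , i≼x , i⋠y = label (toWitness y⋖x)
          _ , _  , _   , i′⋠y′ = label (toWitness y′⋖x)
          i≼y⊔y′ = subst (i ≼_) (sym (⋖-join (toWitness y⋖x) (toWitness y′⋖x) y≢y′)) i≼x
      in case proj₂ jp y y′ i≼y⊔y′ of λ where
        (inj₁ i≼y)  → i⋠y i≼y
        (inj₂ i≼y′) → i′⋠y′ (subst (_≼ y′) i≡i′ i≼y′)
    dropOf : ∀ j → T ⌊ maximal? (joinPrimeBelow? x) j ⌋ → Fin n
    dropOf j maxⱼ = proj₁ (maximalJoinPrime⇒lowerCover (toWitness maxⱼ))
    dropOf-covered : ∀ j maxⱼ → T ⌊ dropOf j maxⱼ ⋖? x ⌋
    dropOf-covered j maxⱼ = fromWitness (proj₁ (proj₂ (maximalJoinPrime⇒lowerCover (toWitness maxⱼ))))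
    dropOf-injective : ∀ {j k} maxⱼ maxₖ → dropOf j maxⱼ ≡ dropOf k maxₖ → j ≡ k
    dropOf-injective maxⱼ maxₖ dⱼ≡dₖ =
      let _ , dⱼ⋖x , j⋠dⱼ = maximalJoinPrime⇒lowerCover (toWitness maxⱼ)
          _ , _ , k⋠dₖ = maximalJoinPrime⇒lowerCover (toWitness maxₖ)
      in label-unique dⱼ⋖x (proj₁ (toWitness maxⱼ)) (proj₁ (toWitness maxₖ)) j⋠dⱼ
                      (subst (λ d → ¬ _ ≼ d) (sym dⱼ≡dₖ) k⋠dₖ)

module DownSet {n} (le : Fin n → Fin n → Bool) {_⊔_ _⊓_ : Fin n → Fin n → Fin n}
  (isDistributiveLattice : IsDistributiveLattice _≡_ (λ x y → T (le x y)) _⊔_ _⊓_)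
  (P : Fin n → Bool) (down : DownClosed le P) where

  open FinDistributiveLattice le isDistributiveLattice
  open Covering le P using (lt; covers; κ; ι)

  T-lt : ∀ {x y} → T (lt x y) ⇔ x ≺ y
  T-lt {x} {y} = mk⇔ (λ h → let x≼y , x≢y = T-∧⁻ {le x y} h in x≼y , toWitnessFalse x≢y)
                     (λ (x≼y , x≢y) → T-∧⁺ x≼y (fromWitnessFalse x≢y))

  covers⇔⋖ : ∀ {x y} → T (P x) → T (covers x y) ⇔ y ⋖ x
  covers⇔⋖ {x} {y} Px = mk⇔ to from
    where
    between : Fin n → Bool
    between z = P z ∧ lt y z ∧ lt z x
    to : T (covers x y) → y ⋖ x
    to h = let y≺x , none = T-∧⁻ {lt y x} h in
      Equivalence.to T-lt y≺x , λ z y≺z z≺x → Equivalence.to (T-not {anyFin between}) none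
        (anyFin⁺ {f = between} (T-∧⁺ (down x z Px (proj₁ z≺x))
                                     (T-∧⁺ (Equivalence.from T-lt y≺z) (Equivalence.from T-lt z≺x))))
    from : y ⋖ x → T (covers x y)
    from (y≺x , nothing-between) = T-∧⁺ (Equivalence.from T-lt y≺x) (Equivalence.from T-not λ any →
      let z , h = anyFin⁻ {f = between} any
          y≺z , z≺x = T-∧⁻ {lt y z} (proj₂ (T-∧⁻ {P z} h))
      in nothing-between z (Equivalence.to T-lt y≺z) (Equivalence.to T-lt z≺x))

  lowerCover⇔ : ∀ {x y} → T (P x) → T (P y ∧ covers x y) ⇔ y ⋖ x
  lowerCover⇔ {x} {y} Px = mk⇔ (Equivalence.to (covers⇔⋖ Px) ∘ proj₂ ∘ T-∧⁻ {P y})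
    (λ y⋖x → T-∧⁺ (down x y Px (proj₁ (proj₁ y⋖x))) (Equivalence.from (covers⇔⋖ Px) y⋖x))

  upperCover⇔ : ∀ {y v} → T (P v ∧ covers v y) ⇔ (T (P v) × y ⋖ v)
  upperCover⇔ {y} {v} = mk⇔ (λ h → let Pv , c = T-∧⁻ {P v} h in Pv , Equivalence.to (covers⇔⋖ Pv) c)
                            (λ (Pv , y⋖v) → T-∧⁺ Pv (Equivalence.from (covers⇔⋖ Pv) y⋖v))

  κ≡#maximalJoinPrimes : ∀ {x} → T (P x) → κ x ≡ countFin (λ j → ⌊ maximal? (joinPrimeBelow? x) j ⌋)
  κ≡#maximalJoinPrimes {x} Px = trans
    (countFin-≐ {q = λ y → ⌊ y ⋖? x ⌋} (λ y h → fromWitness (Equivalence.to (lowerCover⇔ Px) h))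
                (λ y h → Equivalence.from (lowerCover⇔ Px) (toWitness h)))
    (#lowerCovers≡#maximalJoinPrimes x)

  Diamond JoinClosed : Set
  Diamond    = ∀ {w y z} → T (P y) → T (P z) → w ⋖ y → w ⋖ z → y ≢ z → T (P (y ⊔ z))
  JoinClosed = ∀ {a b} → T (P a) → T (P b) → T (P (a ⊔ b))

  -- Induction on a ⊓ b, downwards: with w = a ⊓ b ⋖ y ≼ a and w ⋖ z ≼ b, the diamond gives
  -- c = y ⊔ z ∈ P; then a ⊓ c = y and (a ⊔ c) ⊓ b ≽ z both lie strictly above w.
  diamond⇒joinClosed : Diamond → JoinClosed
  diamond⇒joinClosed diamond = All.wfRec (po-noetherian isPartialOrder) _ Goal step _ refl
    where
    Goal : Pred (Fin n) 0ℓ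
    Goal w = ∀ {a b} → a ⊓ b ≡ w → T (P a) → T (P b) → T (P (a ⊔ b))
    step : ∀ w → WfRec (flip _≺_) Goal w → Goal w
    step _ rec {a} {b} refl Pa Pb with a ≼? b | b ≼? a
    ... | yes a≼b | _       = subst (T ∘ P) (sym (x≤y⇒x∨y≈y a≼b)) Pb
    ... | no  _   | yes b≼a = subst (T ∘ P) (sym (trans (∨-comm a b) (x≤y⇒x∨y≈y b≼a))) Pa
    ... | no  a⋠b | no  b⋠a
      with ≺⇒∃⋖ (⋠⇒⊓≺ a⋠b) | ≺⇒∃⋖ (subst (_≺ b) (∧-comm b a) (⋠⇒⊓≺ b⋠a))
    ...   | y , w⋖y , y≼a | z , w⋖z , z≼b =
      subst (T ∘ P) (⊔-absorb c≼a⊔b) (rec w≺[a⊔c]⊓b refl (rec (proj₁ w⋖y) a⊓c≡y Pa Pc) Pb)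
      where
      y≢z : y ≢ z
      y≢z y≡z = ≺⇒⋡ (proj₁ w⋖y) (∧-greatest y≼a (subst (_≼ b) (sym y≡z) z≼b))
      c = y ⊔ z
      Pc : T (P c)
      Pc = diamond (down a y Pa y≼a) (down b z Pb z≼b) w⋖y w⋖z y≢z
      c≼a⊔b : c ≼ a ⊔ b
      c≼a⊔b = ∨-least (≼-trans y≼a (x≤x∨y a b)) (≼-trans z≼b (y≤x∨y a b))
      a⊓c≡y : a ⊓ c ≡ y
      a⊓c≡y = ⊓-⊔-absorb y≼a
        (≼-trans (∧-greatest (x∧y≤x a z) (≼-trans (x∧y≤y a z) z≼b)) (proj₁ (proj₁ w⋖y)))
      w≺[a⊔c]⊓b : a ⊓ b ≺ (a ⊔ c) ⊓ b
      w≺[a⊔c]⊓b = ≺-≼-trans (proj₁ w⋖z) (∧-greatest (≼-trans (y≤x∨y y z) (y≤x∨y a c)) z≼b)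

  commonUpperCover commonLowerCover : Fin n → Fin n → Fin n → Bool
  commonUpperCover y z x = P x ∧ ((P y ∧ covers x y) ∧ ((P z ∧ covers x z) ∧ not ⌊ z ≟ᶠ y ⌋))
  commonLowerCover y z w = P w ∧ ((P y ∧ covers y w) ∧ ((P z ∧ covers z w) ∧ not ⌊ z ≟ᶠ y ⌋))

  commonUpperCover⁻ : ∀ {x y z} → T (commonUpperCover y z x) → T (P x) × y ⋖ x × z ⋖ x × y ≢ z
  commonUpperCover⁻ {x} {y} {z} h =
    let Px , h₁ = T-∧⁻ {P x} h
        y-cover , h₂ = T-∧⁻ {P y ∧ covers x y} h₁
        z-cover , z≢y = T-∧⁻ {P z ∧ covers x z} h₂
    in Px , Equivalence.to (lowerCover⇔ Px) y-cover , Equivalence.to (lowerCover⇔ Px) z-cover ,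
       toWitnessFalse z≢y ∘ sym

  commonLowerCover⁺ : ∀ {w y z} → T (P y) → T (P z) → w ⋖ y → w ⋖ z → y ≢ z → T (commonLowerCover y z w)
  commonLowerCover⁺ {w} {y} Py Pz w⋖y w⋖z y≢z =
    T-∧⁺ (down y w Py (proj₁ (proj₁ w⋖y)))
         (T-∧⁺ (Equivalence.from upperCover⇔ (Py , w⋖y))
               (T-∧⁺ (Equivalence.from upperCover⇔ (Pz , w⋖z)) (fromWitnessFalse (y≢z ∘ sym))))

  #commonUpperCovers≤#commonLowerCovers : ∀ y z →
    countFin (commonUpperCover y z) ℕ.≤ countFin (commonLowerCover y z)
  #commonUpperCovers≤#commonLowerCovers y z =
    countFin-injection (λ _ _ → y ⊓ z) meet-covered
      (λ hₓ hₓ′ _ → trans (sym (join≡ hₓ)) (join≡ hₓ′))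
    where
    join≡ : ∀ {x} → T (commonUpperCover y z x) → y ⊔ z ≡ x
    join≡ h = let _ , y⋖x , z⋖x , y≢z = commonUpperCover⁻ h in ⋖-join y⋖x z⋖x y≢z
    meet-covered : ∀ x → T (commonUpperCover y z x) → T (commonLowerCover y z (y ⊓ z))
    meet-covered x h =
      let Px , y⋖x , z⋖x , y≢z = commonUpperCover⁻ h in
      commonLowerCover⁺ (down x y Px (proj₁ (proj₁ y⋖x))) (down x z Px (proj₁ (proj₁ z⋖x)))
        (⋖-meet y⋖x z⋖x y≢z) (subst (_⋖ z) (∧-comm z y) (⋖-meet z⋖x y⋖x (y≢z ∘ sym))) y≢z

  Kᵘ″1 Kˡ″1 : ℕ
  Kᵘ″1 = ∑[ x < n ] (𝟙 (P x) ℕ.* pairs (κ x))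
  Kˡ″1 = ∑[ x < n ] (𝟙 (P x) ℕ.* pairs (ι x))

  Kᵘ″1≡∑∑#commonUpperCovers : Kᵘ″1 ≡ ∑[ y < n ] ∑[ z < n ] countFin (commonUpperCover y z)
  Kᵘ″1≡∑∑#commonUpperCovers = ∑-pairs P (λ x y → P y ∧ covers x y)

  Kˡ″1≡∑∑#commonLowerCovers : Kˡ″1 ≡ ∑[ y < n ] ∑[ z < n ] countFin (commonLowerCover y z)
  Kˡ″1≡∑∑#commonLowerCovers = ∑-pairs P (λ w y → P y ∧ covers y w)

  Kᵘ″1≤Kˡ″1 : Kᵘ″1 ℕ.≤ Kˡ″1
  Kᵘ″1≤Kˡ″1 = subst₂ ℕ._≤_ (sym Kᵘ″1≡∑∑#commonUpperCovers) (sym Kˡ″1≡∑∑#commonLowerCovers)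
    (∑-mono-≤ (λ y → ∑-mono-≤ (#commonUpperCovers≤#commonLowerCovers y)))

  Kᵘ″1≡Kˡ″1⇒diamond : Kᵘ″1 ≡ Kˡ″1 → Diamond
  Kᵘ″1≡Kˡ″1⇒diamond K″≡ {w} {y} {z} Py Pz w⋖y w⋖z y≢z =
    let x , h = countFin>0⇒∃ (subst (0 ℕ.<_) (sym (#equal y z))
                  (countFin-witness {p = commonLowerCover y z} (commonLowerCover⁺ Py Pz w⋖y w⋖z y≢z)))
        Px , y⋖x , z⋖x , _ = commonUpperCover⁻ h
    in down x (y ⊔ z) Px (∨-least (proj₁ (proj₁ y⋖x)) (proj₁ (proj₁ z⋖x)))
    where
    #equal : ∀ y z → countFin (commonUpperCover y z) ≡ countFin (commonLowerCover y z)
    #equal y = ∑≡∑⇒≗ (#commonUpperCovers≤#commonLowerCovers y)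
      (∑≡∑⇒≗ (λ y → ∑-mono-≤ (#commonUpperCovers≤#commonLowerCovers y))
             (trans (sym Kᵘ″1≡∑∑#commonUpperCovers) (trans K″≡ Kˡ″1≡∑∑#commonLowerCovers)) y)

  joinClosed⇒IsDistLatticeSub : JoinClosed → IsDistLatticeSub le P
  joinClosed⇒IsDistLatticeSub closed =
    (λ (a , Pa) (b , Pb) → a ⊔ b , closed Pa Pb) ,
    (λ (a , Pa) (b , _) → a ⊓ b , down a (a ⊓ b) Pa (x∧y≤x a b)) ,
    record
      { isLattice = record
        { isPartialOrder = On.isPartialOrder proj₁ isPartialOrder
        ; supremum       = λ (a , _) (b , _) → x≤x∨y a b , y≤x∨y a b , λ _ → ∨-least
        ; infimum        = λ (a , _) (b , _) → x∧y≤x a b , x∧y≤y a b , λ _ → ∧-greatest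
        }
      ; ∧-distribˡ-∨ = λ (a , _) (b , _) (c , _) → ∧-distribˡ-∨ a b c
      }

  IsDistLatticeSub⇒joinClosed : IsDistLatticeSub le P → JoinClosed
  IsDistLatticeSub⇒joinClosed (_⊔ₚ_ , _ , isDistributiveLatticeₚ) {a} {b} Pa Pb =
    down (proj₁ s) (a ⊔ b) (proj₂ s) (∨-least (x≤x∨yₚ (a , Pa) (b , Pb)) (y≤x∨yₚ (a , Pa) (b , Pb)))
    where
    open IsDistributiveLattice isDistributiveLatticeₚ using () renaming (x≤x∨y to x≤x∨yₚ; y≤x∨y to y≤x∨yₚ)
    s = (a , Pa) ⊔ₚ (b , Pb)

  JoinPrimeOutside : Fin n → Pred (Fin n) 0ℓ
  JoinPrimeOutside y i = T (P i) × JoinPrime i × ¬ i ≼ y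

  joinPrimeOutside? : ∀ y → U.Decidable (JoinPrimeOutside y)
  joinPrimeOutside? y i = T? (P i) ×-dec joinPrime? i ×-dec ¬? (i ≼? y)

  Avoiding : Fin n → Pred (Fin n) 0ℓ
  Avoiding x t = T (P t) × (∀ j → Maximal (JoinPrimeBelow x) j → ¬ j ≼ t)

  avoiding? : ∀ x → U.Decidable (Avoiding x)
  avoiding? x t = T? (P t) ×-dec all? (λ j → maximal? (joinPrimeBelow? x) j →-dec ¬? (j ≼? t))

  module _ (closed : JoinClosed) where

    ⋖⊔-minimal : ∀ {y k} → T (P y) → Minimal (JoinPrimeOutside y) k → y ⋖ y ⊔ k
    ⋖⊔-minimal {y} {k} Py ((Pk , _ , k⋠y) , min) = ⋠⇒≺⊔ k⋠y , nothing-between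
      where
      nothing-between : ∀ z → y ≺ z → ¬ z ≺ y ⊔ k
      nothing-between z y≺z z≺y⊔k with ⋠⇒∃joinPrime (≺⇒⋡ y≺z)
      ... | i , jpᵢ@(_ , prime) , i≼z , i⋠y with prime y k (≼-trans i≼z (proj₁ z≺y⊔k))
      ...   | inj₁ i≼y = i⋠y i≼y
      ...   | inj₂ i≼k = ≺⇒⋡ z≺y⊔k (∨-least (proj₁ y≺z) (subst (_≼ z) i≡k i≼z))
        where
        Pi = down (y ⊔ k) i (closed Py Pk) (≼-trans i≼z (proj₁ z≺y⊔k))
        i≡k = ≼∧⊀⇒≡ i≼k (min i (Pi , jpᵢ , i⋠y))

    label⊔≡ : ∀ {y v} (y⋖v : y ⋖ v) → y ⊔ proj₁ (label y⋖v) ≡ v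
    label⊔≡ y⋖v = let _ , _ , i≼v , i⋠y = label y⋖v in
      ⋖-squeeze y⋖v (⋠⇒≺⊔ i⋠y) (∨-least (proj₁ (proj₁ y⋖v)) i≼v)

    ι≡#minimalJoinPrimes : ∀ {y} → T (P y) → ι y ≡ countFin (λ k → ⌊ minimal? (joinPrimeOutside? y) k ⌋)
    ι≡#minimalJoinPrimes {y} Py =
      ℕ.≤-antisym (countFin-injection labelOf labelOf-minimal labelOf-injective)
                  (countFin-injection (λ k _ → y ⊔ k) join-covers join-injective)
      where
      IsMinimal : Fin n → Set
      IsMinimal k = T ⌊ minimal? (joinPrimeOutside? y) k ⌋
      cover : ∀ {v} → T (P v ∧ covers v y) → T (P v) × y ⋖ v
      cover = Equivalence.to upperCover⇔
      labelOf : ∀ v → T (P v ∧ covers v y) → Fin n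
      labelOf v h = proj₁ (label (proj₂ (cover h)))
      labelOf-minimal : ∀ v h → IsMinimal (labelOf v h)
      labelOf-minimal v h = fromWitness ((Pi , jpᵢ , i⋠y) , λ k (_ , jpₖ , k⋠y) k≺i →
        proj₂ k≺i (label-unique y⋖v (jpₖ , ≼-trans (proj₁ k≺i) i≼v) (jpᵢ , i≼v) k⋠y i⋠y))
        where
        Pv = proj₁ (cover h)
        y⋖v = proj₂ (cover h)
        jpᵢ = proj₁ (proj₂ (label y⋖v))
        i≼v = proj₁ (proj₂ (proj₂ (label y⋖v)))
        i⋠y = proj₂ (proj₂ (proj₂ (label y⋖v)))
        Pi = down v _ Pv i≼v
      labelOf-injective : ∀ {v v′} h h′ → labelOf v h ≡ labelOf v′ h′ → v ≡ v′
      labelOf-injective h h′ i≡i′ =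
        trans (sym (label⊔≡ (proj₂ (cover h)))) (trans (cong (y ⊔_) i≡i′) (label⊔≡ (proj₂ (cover h′))))
      join-covers : ∀ k → IsMinimal k → T (P (y ⊔ k) ∧ covers (y ⊔ k) y)
      join-covers k min = Equivalence.from upperCover⇔
        (closed Py (proj₁ (proj₁ (toWitness min))) , ⋖⊔-minimal Py (toWitness min))
      join-injective : ∀ {k k′} → IsMinimal k → IsMinimal k′ → y ⊔ k ≡ y ⊔ k′ → k ≡ k′
      join-injective {k} {k′} min min′ y⊔k≡y⊔k′ =
        let (_ , jpₖ , k⋠y) , _ = toWitness min
            (_ , jpₖ′ , k′⋠y) , _ = toWitness min′
        in label-unique (⋖⊔-minimal Py (toWitness min)) (jpₖ , y≤x∨y y k)
             (jpₖ′ , subst (k′ ≼_) (sym y⊔k≡y⊔k′) (y≤x∨y y k′)) k⋠y k′⋠y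

    avoiding-⊔-closed : ∀ {x a b} → Avoiding x a → Avoiding x b → Avoiding x (a ⊔ b)
    avoiding-⊔-closed (Pa , a-avoids) (Pb , b-avoids) = closed Pa Pb , λ j maxⱼ j≼a⊔b →
      case proj₂ (proj₁ (proj₁ maxⱼ)) _ _ j≼a⊔b of λ where
        (inj₁ j≼a) → a-avoids j maxⱼ j≼a
        (inj₂ j≼b) → b-avoids j maxⱼ j≼b

    bottom-avoiding : ∀ x → T (P x) → Avoiding x (proj₁ (∃-bottom x))
    bottom-avoiding x Px = down x ⊥ Px (⊥≼ x) , avoids
      where
      ⊥ = proj₁ (∃-bottom x)
      ⊥≼ = proj₂ (∃-bottom x)
      avoids : ∀ j → Maximal (JoinPrimeBelow x) j → ¬ j ≼ ⊥
      avoids j ((((y₀ , j⋠y₀) , _) , _) , _) j≼⊥ = j⋠y₀ (≼-trans j≼⊥ (⊥≼ y₀))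

    -- The greatest element of P above no maximal join-prime below x: its upper covers in P are
    -- labelled by exactly the join-primes that label the lower covers of x.
    φ : ∀ x → T (P x) → Fin n
    φ x Px = proj₁ (maximal-above (avoiding? x) (bottom-avoiding x Px))

    φ-maximal : ∀ x Px → Maximal (Avoiding x) (φ x Px)
    φ-maximal x Px = proj₂ (proj₂ (maximal-above (avoiding? x) (bottom-avoiding x Px)))

    φ-greatest : ∀ {x Px t} → Avoiding x t → t ≼ φ x Px
    φ-greatest {x} {Px} = Maximal-⊔-closed⇒greatest avoiding-⊔-closed (φ-maximal x Px)

    outside-φ⇒above-maximal : ∀ {x Px k} → JoinPrimeOutside (φ x Px) k →
                              ∃ λ j → Maximal (JoinPrimeBelow x) j × j ≼ k
    outside-φ⇒above-maximal {x} {Px} {k} (Pk , _ , k⋠φ)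
      with any? (λ j → maximal? (joinPrimeBelow? x) j ×-dec (j ≼? k))
    ... | yes found = found
    ... | no  ∄j    = contradiction (φ-greatest {Px = Px} (Pk , λ j maxⱼ j≼k → ∄j (j , maxⱼ , j≼k))) k⋠φ

    maximal⇒minimal : ∀ {x Px j} → Maximal (JoinPrimeBelow x) j → Minimal (JoinPrimeOutside (φ x Px)) j
    maximal⇒minimal {x} {Px} {j} maxⱼ@((jpⱼ , j≼x) , _) =
      (down x j Px j≼x , jpⱼ , proj₂ (proj₁ (φ-maximal x Px)) j maxⱼ) , λ k outₖ k≺j →
        let j′ , maxⱼ′ , j′≼k = outside-φ⇒above-maximal {Px = Px} outₖ
        in proj₂ maxⱼ′ j (jpⱼ , j≼x) (≼-≺-trans j′≼k k≺j)

    minimal⇒maximal : ∀ {x Px j} → Minimal (JoinPrimeOutside (φ x Px)) j → Maximal (JoinPrimeBelow x) j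
    minimal⇒maximal {x} {Px} {j} (outⱼ , min) =
      let j′ , maxⱼ′ , j′≼j = outside-φ⇒above-maximal {Px = Px} outⱼ
          j′≡j = ≼∧⊀⇒≡ j′≼j (min j′ (proj₁ (maximal⇒minimal {Px = Px} maxⱼ′)))
      in subst (Maximal (JoinPrimeBelow x)) j′≡j maxⱼ′

    ι∘φ≡κ : ∀ x Px → ι (φ x Px) ≡ κ x
    ι∘φ≡κ x Px = begin
      ι (φ x Px)
        ≡⟨ ι≡#minimalJoinPrimes (proj₁ (proj₁ (φ-maximal x Px))) ⟩
      countFin (λ j → ⌊ minimal? (joinPrimeOutside? (φ x Px)) j ⌋)
        ≡⟨ countFin-≐ {p = λ j → ⌊ minimal? (joinPrimeOutside? (φ x Px)) j ⌋}
                      {q = λ j → ⌊ maximal? (joinPrimeBelow? x) j ⌋}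
                      (λ j → fromWitness ∘ minimal⇒maximal {Px = Px} ∘ toWitness)
                      (λ j → fromWitness ∘ maximal⇒minimal {Px = Px} ∘ toWitness) ⟩
      countFin (λ j → ⌊ maximal? (joinPrimeBelow? x) j ⌋)
        ≡⟨ sym (κ≡#maximalJoinPrimes Px) ⟩
      κ x ∎
      where open ≡-Reasoning

    φ-≼ : ∀ {x x′ Px Px′} → φ x Px ≡ φ x′ Px′ → x ≼ x′
    φ-≼ {x} {x′} {Px} {Px′} φ≡φ′ = ≼-byJoinPrimes λ i jpᵢ i≼x →
      let j , i≼j , maxⱼ = maximal-above (joinPrimeBelow? x) (jpᵢ , i≼x)
          minⱼ = subst (λ m → Minimal (JoinPrimeOutside m) j) φ≡φ′ (maximal⇒minimal {Px = Px} maxⱼ)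
      in ≼-trans i≼j (proj₂ (proj₁ (minimal⇒maximal {Px = Px′} minⱼ)))

    Kᵘ≤Kˡ : ∀ k → countFin (λ x → P x ∧ (κ x ≡ᵇ k)) ℕ.≤ countFin (λ x → P x ∧ (ι x ≡ᵇ k))
    Kᵘ≤Kˡ k = countFin-injection (λ x h → φ x (∈P h)) φ-preserves
      (λ h h′ φ≡φ′ → antisym (φ-≼ φ≡φ′) (φ-≼ (sym φ≡φ′)))
      where
      ∈P : ∀ {x} → T (P x ∧ (κ x ≡ᵇ k)) → T (P x)
      ∈P {x} = proj₁ ∘ T-∧⁻ {P x}
      φ-preserves : ∀ x h → T (P (φ x (∈P h)) ∧ (ι (φ x (∈P h)) ≡ᵇ k))
      φ-preserves x h = T-∧⁺ (proj₁ (proj₁ (φ-maximal x (∈P h))))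
        (subst (λ m → T (m ≡ᵇ k)) (sym (ι∘φ≡κ x (∈P h))) (proj₂ (T-∧⁻ {P x} h)))

  Kᵘ≡Kˡ : JoinClosed → ∀ k → countFin (λ x → P x ∧ (κ x ≡ᵇ k)) ≡ countFin (λ x → P x ∧ (ι x ≡ᵇ k))
  Kᵘ≡Kˡ closed k =
    fibres-dominated⇒≡ (suc (k ℕ.+ n)) P κ ι (λ _ → bound) (λ _ → bound) (Kᵘ≤Kˡ closed) k (s≤s (ℕ.m≤m+n k n))
    where
    bound : ∀ {p : Fin n → Bool} → countFin p ℕ.< suc (k ℕ.+ n)
    bound = s≤s (ℕ.≤-trans (countFin≤n _) (ℕ.m≤n+m n k))

  module CoveringPolynomial (D : Poly)
    (K-difference : ∀ k → Covering.Kᵘ-coeff le P k - Covering.Kˡ-coeff le P k ≡ sqMul-coeff D k) where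

    2*eval1≡Kᵘ″1-Kˡ″1 : + 2 * eval1 D ≡ + Kᵘ″1 - + Kˡ″1
    2*eval1≡Kᵘ″1-Kˡ″1 = begin
      + 2 * eval1 D
        ≡⟨ sym (secondMoment-sqMul≡2*eval1 D (length D ℕ.+ n) (ℕ.m≤m+n (length D) n)) ⟩
      secondMoment D N
        ≡⟨ ℤΣ.sum-cong-≗ {N} (λ k → trans (cong (_*_ (+ pairs (toℕ k))) (sym (K-difference (toℕ k))))
                                          (+*-difference (pairs (toℕ k)) (Kᵘ (toℕ k)) (Kˡ (toℕ k)))) ⟩
      ℤΣ.sum {N} (λ k → + (Kᵘ (toℕ k) ℕ.* pairs (toℕ k)) - + (Kˡ (toℕ k) ℕ.* pairs (toℕ k)))
        ≡⟨ ∑ᶻ-difference {N} (λ k → Kᵘ (toℕ k) ℕ.* pairs (toℕ k))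
                             (λ k → Kˡ (toℕ k) ℕ.* pairs (toℕ k)) ⟩
      + (∑[ k < N ] (Kᵘ (toℕ k) ℕ.* pairs (toℕ k))) - + (∑[ k < N ] (Kˡ (toℕ k) ℕ.* pairs (toℕ k)))
        ≡⟨ sym (cong₂ (λ a b → + a - + b) (∑-fibres {N = N} P κ pairs (λ _ → bound))
                                           (∑-fibres {N = N} P ι pairs (λ _ → bound))) ⟩
      + Kᵘ″1 - + Kˡ″1 ∎
      where
      open ≡-Reasoning
      N = 2 ℕ.+ (length D ℕ.+ n)
      Kᵘ Kˡ : ℕ → ℕ
      Kᵘ k = countFin (λ x → P x ∧ (κ x ≡ᵇ k))
      Kˡ k = countFin (λ x → P x ∧ (ι x ≡ᵇ k))
      bound : ∀ {p : Fin n → Bool} → countFin p ℕ.< N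
      bound = ℕ.≤-trans (s≤s (ℕ.≤-trans (countFin≤n _) (ℕ.m≤n+m n (length D)))) (ℕ.n≤1+n _)

    eval1≤0 : eval1 D ≤ + 0
    eval1≤0 = ℤ.*-cancelˡ-≤-pos (eval1 D) (+ 0) (+ 2)
      (subst (_≤ + 0) (sym 2*eval1≡Kᵘ″1-Kˡ″1) (ℤ.i≤j⇒i-j≤0 (+≤+ Kᵘ″1≤Kˡ″1)))

    eval1≡0⇒joinClosed : eval1 D ≡ + 0 → JoinClosed
    eval1≡0⇒joinClosed D1≡0 = diamond⇒joinClosed (Kᵘ″1≡Kˡ″1⇒diamond (ℤ.+-injective
      (ℤ.i-j≡0⇒i≡j _ _ (trans (sym 2*eval1≡Kᵘ″1-Kˡ″1) (cong (_*_ (+ 2)) D1≡0)))))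

    joinClosed⇒IsZeroPoly : JoinClosed → IsZeroPoly D
    joinClosed⇒IsZeroPoly closed = sqMul-coeff≡0⇒IsZeroPoly D λ k →
        trans (sym (K-difference k))
            (trans (cong (λ c → Covering.Kᵘ-coeff le P k - + c) (sym (Kᵘ≡Kˡ closed k)))
                   (ℤ.+-inverseʳ (Covering.Kᵘ-coeff le P k)))

proposition1p7 : (n : ℕ) (le : Fin n → Fin n → Bool) → IsDistLatticeOrder le →
    (P : Fin n → Bool) → DownClosed le P →
    (D : Poly) →
    (∀ k → Covering.Kᵘ-coeff le P k - Covering.Kˡ-coeff le P k ≡ sqMul-coeff D k) →
    (eval1 D ≤ + 0)
    × ((eval1 D ≡ + 0) ⇔ IsDistLatticeSub le P)
    × (IsDistLatticeSub le P ⇔ IsZeroPoly D)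
proposition1p7 n le (_ , _ , isDistributiveLattice) P down D K-difference =
  eval1≤0 ,
  mk⇔ (joinClosed⇒IsDistLatticeSub ∘ eval1≡0⇒joinClosed)
      (IsZeroPoly⇒eval1≡0 D ∘ joinClosed⇒IsZeroPoly ∘ IsDistLatticeSub⇒joinClosed) ,
  mk⇔ (joinClosed⇒IsZeroPoly ∘ IsDistLatticeSub⇒joinClosed)
      (joinClosed⇒IsDistLatticeSub ∘ eval1≡0⇒joinClosed ∘ IsZeroPoly⇒eval1≡0 D)
  where
  open DownSet le isDistributiveLattice P down
  open DownSet.CoveringPolynomial le isDistributiveLattice P down D K-difference
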